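{- Let $S$ be a finite set and let $u:\mathbb{H}^D(S)\to\mathbb{R}$ be a non-decreasing, sequence-submodular sequence function. Then for any $A,B\in\mathbb{H}^D(S)$ with $|B|\ge 1$ there exists $s\in S$ such that $$u(s\mid A)\ \ge\ \frac{1}{|B|}\,u(B\mid A).$$
   Context: A discrete sequence over $S$ is a finite tuple $A=(s_1,\dots,s_k)$ with $k\in\mathbb{N}\cup\{0\}$ and $s_i\in S$; $\mathbb{H}^D(S)$ is the set of all of them, $|A|=k$ is its length and $\emptyset$ denotes the empty sequence. $A\bot B$ denotes concatenation, and for $s\in S$ we write $A\bot s$ for $A\bot(s)$. $A\prec B$ ($A$ is dominated by $B$) means that $A$ is a (not necessarily contiguous) subsequence of $B$. For $u:\mathbb{H}^D(S)\to\mathbb{R}$ the marginal value is $u(B\mid A)=u(A\bot B)-u(A)$; in particular $u(s\mid A)=u(A\bot(s))-u(A)$. The function $u$ is non-decreasing if $u(\emptyset)=0$ and $A\prec B\Rightarrow u(A)\le u(B)$ for all $A,B$. It is sequence-submodular if for all $A,B,C\in\mathbb{H}^D(S)$ with $A\prec B$, $u(C\mid A)\ge u(C\mid B)$. -}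

module Defs where

open import Level using (0ℓ)
open import Data.Nat using (ℕ; zero; suc)
open import Data.List using (List; []; _∷_; _++_)
open import Data.List.Relation.Binary.Sublist.Propositional using (_⊆_)
open import Relation.Binary.PropositionalEquality using (_≡_)
open import Relation.Binary.Core using (Rel)
open import Relation.Binary.Structures using (IsTotalOrder)
open import Relation.Nullary using (¬_)
open import Algebra.Structures using (IsCommutativeRing)
open import Data.Product using (_×_)

-- An ordered field (with propositional equality), standing in for ℝ,
-- which is not available in agda-stdlib.  ℝ is a model of this record.
-- Inverse is total, with the inverse law only required for nonzero x.
record OrderedField : Set₁ where
  infixl 6 _+_ _-_
  infixl 7 _*_
  infix 4 _≤_
  field
    Carrier : Set
    _+_ _*_ : Carrier → Carrier → Carrier
    -_ : Carrier → Carrier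
    0# 1# : Carrier
    _⁻¹ : Carrier → Carrier
    _≤_ : Rel Carrier 0ℓ
    isCommutativeRing : IsCommutativeRing _≡_ _+_ _*_ -_ 0# 1#
    isTotalOrder : IsTotalOrder _≡_ _≤_
    0≢1 : ¬ (0# ≡ 1#)
    ⁻¹-inverse : ∀ x → ¬ (x ≡ 0#) → x * (x ⁻¹) ≡ 1#
    +-monoˡ-≤ : ∀ {x y} z → x ≤ y → x + z ≤ y + z
    *-nonneg : ∀ {x y} → 0# ≤ x → 0# ≤ y → 0# ≤ x * y

  _-_ : Carrier → Carrier → Carrier
  x - y = x + (- y)

  fromℕ : ℕ → Carrier
  fromℕ zero    = 0#
  fromℕ (suc n) = 1# + fromℕ n

module SequenceFunctions (F : OrderedField) {S : Set} where
  open OrderedField F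

  -- discrete sequences over S are lists; A ⊥ B is A ++ B;
  -- A ≺ B (subsequence, not necessarily contiguous) is the stdlib Sublist A ⊆ B.

  marginal : (List S → Carrier) → List S → List S → Carrier
  marginal u B A = u (A ++ B) - u A

  NonDecreasing : (List S → Carrier) → Set
  NonDecreasing u = (u [] ≡ 0#) × (∀ (A B : List S) → A ⊆ B → u A ≤ u B)

  SequenceSubmodular : (List S → Carrier) → Set
  SequenceSubmodular u =
    ∀ (A B C : List S) → A ⊆ B → marginal u C B ≤ marginal u C A

module Submission where

-- Write m(s) = u(s | A).  Splitting off the first element b of B = b ∷ B'
-- gives the chain rule  u(b ∷ B' | A) = u(B' | A ⊥ b) + m(b), and
-- submodularity (A ≺ A ⊥ b) bounds the first summand by u(B' | A).
-- Hence, by induction on B, u(B | A) ≤ |B| · m(s) for some s: if u(B' | A) ≤ |B'| · m(s') then  |B'| · m(s') + m(b)  is at most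
-- (1 + |B'|) times the larger of m(s') and m(b).  Dividing by |B| ≥ 1
-- gives the theorem.

open import Defs
open import Data.Nat using (ℕ; zero; suc)
open import Data.Fin using (Fin)
open import Data.List using (List; [_]; length; []; _∷_; _++_)
open import Data.List.Properties using (++-assoc; ++-identityʳ)
open import Data.List.Relation.Binary.Sublist.Propositional using (⊆-refl)
open import Data.List.Relation.Binary.Sublist.Propositional.Properties using (++⁺ʳ)
open import Data.Product using (∃; _,_)
open import Data.Sum using (_⊎_; inj₁; inj₂)
open import Relation.Binary.PropositionalEquality using (_≡_; sym; cong; subst)
open import Relation.Nullary using (¬_)
open import Data.Empty using (⊥-elim)
open import Algebra.Bundles using (Ring)
open import Algebra.Structures using (IsCommutativeRing)
open import Relation.Binary.Bundles using (Poset)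
open import Relation.Binary.Structures using (IsTotalOrder)
import Algebra.Properties.Ring as RingProperties
import Relation.Binary.Reasoning.PartialOrder as PosetReasoning

module OrderedFieldFacts (F : OrderedField) where
  open OrderedField F
  open IsCommutativeRing isCommutativeRing
    using (+-identityˡ; +-identityʳ; +-assoc; +-comm; -‿inverseˡ; -‿inverseʳ;
           *-identityˡ; *-assoc; *-comm; distribʳ; zeroˡ; isRing)
  open IsTotalOrder isTotalOrder using (total; antisym; isPartialOrder)
    renaming (refl to ≤-refl; trans to ≤-trans) public

  ring : Ring _ _
  ring = record { isRing = isRing }

  open RingProperties ring using (-‿involutive; -‿distribˡ-*; -‿distribʳ-*; x[y-z]≈xy-xz)

  poset : Poset _ _ _
  poset = record { isPartialOrder = isPartialOrder }

  open PosetReasoning poset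

  ≤⇒0≤- : ∀ {x y} → x ≤ y → 0# ≤ y - x
  ≤⇒0≤- {x} {y} x≤y = begin
    0#      ≡⟨ sym (-‿inverseʳ x) ⟩
    x - x   ≤⟨ +-monoˡ-≤ (- x) x≤y ⟩
    y - x   ∎

  0≤-⇒≤ : ∀ {x y} → 0# ≤ y - x → x ≤ y
  0≤-⇒≤ {x} {y} 0≤y-x = begin
    x              ≡⟨ sym (+-identityˡ x) ⟩
    0# + x         ≤⟨ +-monoˡ-≤ x 0≤y-x ⟩
    (y - x) + x    ≡⟨ +-assoc y (- x) x ⟩
    y + (- x + x)  ≡⟨ cong (y +_) (-‿inverseˡ x) ⟩
    y + 0#         ≡⟨ +-identityʳ y ⟩
    y              ∎

  ≤0⇒0≤neg : ∀ {x} → x ≤ 0# → 0# ≤ - x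
  ≤0⇒0≤neg {x} x≤0 = subst (0# ≤_) (+-identityˡ (- x)) (≤⇒0≤- x≤0)

  0≤neg⇒≤0 : ∀ {x} → 0# ≤ - x → x ≤ 0#
  0≤neg⇒≤0 {x} 0≤-x = 0≤-⇒≤ (subst (0# ≤_) (sym (+-identityˡ (- x))) 0≤-x)

  +-mono-≤ : ∀ {a b c d} → a ≤ b → c ≤ d → a + c ≤ b + d
  +-mono-≤ {a} {b} {c} {d} a≤b c≤d = begin
    a + c  ≤⟨ +-monoˡ-≤ c a≤b ⟩
    b + c  ≡⟨ +-comm b c ⟩
    c + b  ≤⟨ +-monoˡ-≤ b c≤d ⟩
    d + b  ≡⟨ +-comm d b ⟩
    b + d  ∎

  *-monoʳ-≤ : ∀ {c x y} → 0# ≤ c → x ≤ y → c * x ≤ c * y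
  *-monoʳ-≤ {c} {x} {y} 0≤c x≤y =
    0≤-⇒≤ (subst (0# ≤_) (x[y-z]≈xy-xz c y x) (*-nonneg 0≤c (≤⇒0≤- x≤y)))

  -- 1 is positive, since it is the square of both 1 and -1.
  0≤1 : 0# ≤ 1#
  0≤1 with total 0# 1#
  ... | inj₁ 0≤1 = 0≤1
  ... | inj₂ 1≤0 = subst (0# ≤_) minus-one-squared (*-nonneg 0≤-1 0≤-1)
    where
    0≤-1 : 0# ≤ - 1#
    0≤-1 = ≤0⇒0≤neg 1≤0

    minus-one-squared : - 1# * - 1# ≡ 1#
    minus-one-squared = begin-equality
      - 1# * - 1#    ≡⟨ sym (-‿distribˡ-* 1# (- 1#)) ⟩
      - (1# * - 1#)  ≡⟨ cong -_ (*-identityˡ (- 1#)) ⟩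
      - (- 1#)       ≡⟨ -‿involutive 1# ⟩
      1#             ∎

  -- The inverse of a positive element is non-negative: otherwise
  -- x · (- x⁻¹) = -1 would be non-negative.
  ⁻¹-nonneg : ∀ {x} → 0# ≤ x → ¬ (x ≡ 0#) → 0# ≤ x ⁻¹
  ⁻¹-nonneg {x} 0≤x x≢0 with total 0# (x ⁻¹)
  ... | inj₁ 0≤x⁻¹ = 0≤x⁻¹
  ... | inj₂ x⁻¹≤0 = contradiction
    where
    0≤-1 : 0# ≤ - 1#
    0≤-1 = begin
      0#              ≤⟨ *-nonneg 0≤x (≤0⇒0≤neg x⁻¹≤0) ⟩
      x * - (x ⁻¹)    ≡⟨ sym (-‿distribʳ-* x (x ⁻¹)) ⟩
      - (x * x ⁻¹)    ≡⟨ cong -_ (⁻¹-inverse x x≢0) ⟩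
      - 1#            ∎

    contradiction : 0# ≤ x ⁻¹
    contradiction = ⊥-elim (0≢1 (antisym 0≤1 (0≤neg⇒≤0 0≤-1)))

  divide-≤ : ∀ {c x m} → 0# ≤ c → ¬ (c ≡ 0#) → x ≤ c * m → c ⁻¹ * x ≤ m
  divide-≤ {c} {x} {m} 0≤c c≢0 x≤cm = begin
    c ⁻¹ * x        ≤⟨ *-monoʳ-≤ (⁻¹-nonneg 0≤c c≢0) x≤cm ⟩
    c ⁻¹ * (c * m)  ≡⟨ sym (*-assoc (c ⁻¹) c m) ⟩
    c ⁻¹ * c * m    ≡⟨ cong (_* m) (*-comm (c ⁻¹) c) ⟩
    c * c ⁻¹ * m    ≡⟨ cong (_* m) (⁻¹-inverse c c≢0) ⟩
    1# * m          ≡⟨ *-identityˡ m ⟩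
    m               ∎

  fromℕ-nonneg : ∀ k → 0# ≤ fromℕ k
  fromℕ-nonneg zero    = ≤-refl
  fromℕ-nonneg (suc k) = begin
    0#             ≡⟨ sym (+-identityʳ 0#) ⟩
    0# + 0#        ≤⟨ +-mono-≤ 0≤1 (fromℕ-nonneg k) ⟩
    1# + fromℕ k   ∎

  fromℕ-suc≢0 : ∀ k → ¬ (fromℕ (suc k) ≡ 0#)
  fromℕ-suc≢0 k 1+k≡0 = 0≢1 (antisym 0≤1 1≤0)
    where
    1≤0 : 1# ≤ 0#
    1≤0 = begin
      1#             ≡⟨ sym (+-identityʳ 1#) ⟩
      1# + 0#        ≤⟨ +-mono-≤ ≤-refl (fromℕ-nonneg k) ⟩
      1# + fromℕ k   ≡⟨ 1+k≡0 ⟩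
      0#             ∎

  k*z+z≡[1+k]*z : ∀ k z → k * z + z ≡ (1# + k) * z
  k*z+z≡[1+k]*z k z = begin-equality
    k * z + z        ≡⟨ +-comm (k * z) z ⟩
    z + k * z        ≡⟨ cong (_+ k * z) (sym (*-identityˡ z)) ⟩
    1# * z + k * z   ≡⟨ sym (distribʳ z 1# k) ⟩
    (1# + k) * z     ∎

  scaled-sum-≤ : ∀ {k} → 0# ≤ k → ∀ x y →
                 (k * x + y ≤ (1# + k) * x) ⊎ (k * x + y ≤ (1# + k) * y)
  scaled-sum-≤ {k} 0≤k x y with total x y
  ... | inj₁ x≤y = inj₂ (begin
    k * x + y     ≤⟨ +-monoˡ-≤ y (*-monoʳ-≤ 0≤k x≤y) ⟩
    k * y + y     ≡⟨ k*z+z≡[1+k]*z k y ⟩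
    (1# + k) * y  ∎)
  ... | inj₂ y≤x = inj₁ (begin
    k * x + y     ≤⟨ +-mono-≤ ≤-refl y≤x ⟩
    k * x + x     ≡⟨ k*z+z≡[1+k]*z k x ⟩
    (1# + k) * x  ∎)

  0≤0*x : ∀ x → 0# ≤ 0# * x
  0≤0*x x = subst (0# ≤_) (sym (zeroˡ x)) ≤-refl

module Marginals (F : OrderedField) {S : Set} (u : List S → OrderedField.Carrier F) where
  open OrderedField F
  open IsCommutativeRing isCommutativeRing using (+-identityˡ; +-assoc; -‿inverseˡ; -‿inverseʳ)
  open OrderedFieldFacts F
  open SequenceFunctions F {S}
  open PosetReasoning poset

  marginal-[] : ∀ A → marginal u [] A ≡ 0#
  marginal-[] A = begin-equality
    u (A ++ []) - u A  ≡⟨ cong (λ L → u L - u A) (++-identityʳ A) ⟩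
    u A - u A          ≡⟨ -‿inverseʳ (u A) ⟩
    0#                 ∎

  marginal-∷ : ∀ A b B → marginal u (b ∷ B) A ≡ marginal u B (A ++ [ b ]) + marginal u [ b ] A
  marginal-∷ A b B = begin-equality
    u (A ++ b ∷ B) - u A                         ≡⟨ cong (λ L → u L - u A) (sym (++-assoc A [ b ] B)) ⟩
    Ab++B - u A                                  ≡⟨ cong (λ t → Ab++B + t) (sym cancel) ⟩
    Ab++B + (- u Ab + (u Ab - u A))              ≡⟨ sym (+-assoc Ab++B (- u Ab) (u Ab - u A)) ⟩
    (Ab++B - u Ab) + (u Ab - u A)                ∎
    where
    Ab    = A ++ [ b ]
    Ab++B = u (Ab ++ B)

    cancel : - u Ab + (u Ab - u A) ≡ - u A
    cancel = begin-equality
      - u Ab + (u Ab - u A)   ≡⟨ sym (+-assoc (- u Ab) (u Ab) (- u A)) ⟩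
      (- u Ab + u Ab) - u A   ≡⟨ cong (_- u A) (-‿inverseˡ (u Ab)) ⟩
      0# - u A                ≡⟨ +-identityˡ (- u A) ⟩
      - u A                   ∎

  module _ (submodular : SequenceSubmodular u) where

    marginal-∷-≤ : ∀ A b B → marginal u (b ∷ B) A ≤ marginal u B A + marginal u [ b ] A
    marginal-∷-≤ A b B = begin
      marginal u (b ∷ B) A                          ≡⟨ marginal-∷ A b B ⟩
      marginal u B (A ++ [ b ]) + marginal u [ b ] A
        ≤⟨ +-monoˡ-≤ (marginal u [ b ] A) (submodular A (A ++ [ b ]) B (++⁺ʳ [ b ] ⊆-refl)) ⟩
      marginal u B A + marginal u [ b ] A           ∎

    prepend-bound : ∀ {A b B x} → marginal u B A ≤ x →
                    marginal u (b ∷ B) A ≤ x + marginal u [ b ] A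
    prepend-bound {A} {b} {B} B≤x = ≤-trans (marginal-∷-≤ A b B) (+-monoˡ-≤ (marginal u [ b ] A) B≤x)

    best-element : ∀ A b B →
      ∃ λ s → marginal u (b ∷ B) A ≤ fromℕ (length (b ∷ B)) * marginal u [ s ] A
    best-element A b B = extend (bound B)
      where
      Bound : List S → Set
      Bound B = ∃ λ s → marginal u B A ≤ fromℕ (length B) * marginal u [ s ] A

      -- Prepending b to B keeps the bound, choosing the better of b and
      -- the element witnessing the bound for B.
      extend : ∀ {B} → Bound B → Bound (b ∷ B)
      extend {B} (s , gain≤) with scaled-sum-≤ (fromℕ-nonneg (length B)) (marginal u [ s ] A) (marginal u [ b ] A)
      ... | inj₁ s-better = s , ≤-trans (prepend-bound gain≤) s-better
      ... | inj₂ b-better = b , ≤-trans (prepend-bound gain≤) b-better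

      bound : ∀ B → Bound B
      bound []      = b , subst (_≤ 0# * marginal u [ b ] A) (sym (marginal-[] A)) (0≤0*x _)
      bound (c ∷ B) = best-element A c B

open import Data.Nat using (_≤_)

mainTheorem1 : (F : OrderedField) (n : ℕ) (u : List (Fin n) → OrderedField.Carrier F) →
    SequenceFunctions.NonDecreasing F u →
    SequenceFunctions.SequenceSubmodular F u →
    (A B : List (Fin n)) → 1 ≤ length B →
    ∃ λ (s : Fin n) →
      OrderedField._≤_ F
        (OrderedField._*_ F (OrderedField._⁻¹ F (OrderedField.fromℕ F (length B)))
          (SequenceFunctions.marginal F u B A))
        (SequenceFunctions.marginal F u [ s ] A)
mainTheorem1 F _ u _ submodular A (b ∷ B) _
  with Marginals.best-element F u submodular A b B
... | s , gain≤ = s , divide-≤ (fromℕ-nonneg (length (b ∷ B))) (fromℕ-suc≢0 (length B)) gain≤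
  where open OrderedFieldFacts F
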